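{- Let $t$ be a clean vsub-term and $u$ a $\lambda$-term. (1) If $t{\downarrow}\to_{\beta_\lambda}u$ then $t\to_{\mathtt m}\to_{\mathtt e_\lambda}s$ for some clean vsub-term $s$ with $s{\downarrow}=u$. (2) If $t{\downarrow}\to_{\beta_i}u$ then $t\to_{\mathtt m} r\equiv s$ for some vsub-term $r$ and some clean vsub-term $s$ with $s{\downarrow}=u$.
   Context: $\lambda$-terms: $t,u::= v\mid tu$, values $v::= x\mid \lambda x.t$, up to $\alpha$; $t\{x\leftarrow u\}$ capture-avoiding substitution. Fireball calculus: fireballs $f::=\lambda x.t\mid i$, inert terms $i::= x f_1\dots f_n$ ($n\ge0$); $\to_{\beta_\lambda}$, $\to_{\beta_i}$ are closures under contexts $E::=\langle\cdot\rangle\mid tE\mid Et$ of $(\lambda x.t)(\lambda y.u)\mapsto t\{x\leftarrow \lambda y.u\}$ and $(\lambda x.t)i\mapsto t\{x\leftarrow i\}$ ($i$ inert). Value substitution calculus: vsub-terms $t,u,s::= v\mid tu\mid t[x\leftarrow u]$, vsub-values $v::=x\mid\lambda x.t$; $t[x\leftarrow u]$ binds $x$ in $t$. Evaluation contexts $E::=\langle\cdot\rangle\mid tE\mid Et\mid E[x\leftarrow u]\mid t[x\leftarrow E]$; substitution contexts $L::=\langle\cdot\rangle\mid L[x\leftarrow u]$. $\to_{\mathtt m}$, $\to_{\mathtt e_\lambda}$: closures under evaluation contexts of $L\langle\lambda x.t\rangle u\mapsto L\langle t[x\leftarrow u]\rangle$ and $t[x\leftarrow L\langle \lambda y.u\rangle]\mapsto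 L\langle t\{x\leftarrow\lambda y.u\}\rangle$ (bound variables of $L$ not free in $u$, resp. $t$). Structural equivalence $\equiv$: least equivalence on vsub-terms closed under evaluation contexts containing $t[y\leftarrow s][x\leftarrow u]\equiv t[x\leftarrow u][y\leftarrow s]$ ($y\notin\mathrm{fv}(u)$, $x\notin\mathrm{fv}(s)$); $t\,(s[x\leftarrow u])\equiv (ts)[x\leftarrow u]$ ($x\notin\mathrm{fv}(t)$); $t[x\leftarrow u]\,s\equiv (ts)[x\leftarrow u]$ ($x\notin\mathrm{fv}(s)$); $t[x\leftarrow u[y\leftarrow s]]\equiv t[x\leftarrow u][y\leftarrow s]$ ($y\notin\mathrm{fv}(t)$). Unfolding: $x{\downarrow}=x$, $(tu){\downarrow}=t{\downarrow}u{\downarrow}$, $(\lambda x.t){\downarrow}=\lambda x.t{\downarrow}$, $(t[x\leftarrow u]){\downarrow}=t{\downarrow}\{x\leftarrow u{\downarrow}\}$. A vsub-term is clean if it is $u[x_1\leftarrow i_1]\dots[x_n\leftarrow i_n]$ ($n\ge0$) with $u$ a $\lambda$-term and each $i_j$ an inert $\lambda$-term. -}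

module Defs where

-- Well-scoped de Bruijn syntax: a term of type `Tm n` / `VT n` has at most n
-- free variables (Fin n).  Terms are therefore identified up to α, and
-- syntactic equality _≡_ is α-equivalence.

open import Data.Nat using (ℕ; zero; suc)
open import Data.Fin using (Fin; zero; suc)
open import Data.Product using (Σ; _×_; _,_)
open import Relation.Binary.PropositionalEquality using (_≡_)

Ren : ℕ → ℕ → Set
Ren n m = Fin n → Fin m

liftR : ∀ {n m} → Ren n m → Ren (suc n) (suc m)
liftR ρ zero    = zero
liftR ρ (suc i) = suc (ρ i)

swapR : ∀ {n} → Ren (suc (suc n)) (suc (suc n))
swapR zero          = suc zero
swapR (suc zero)    = zero
swapR (suc (suc i)) = suc (suc i)

data Tm (n : ℕ) : Set where
  var : Fin n → Tm n
  lam : Tm (suc n) → Tm n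
  app : Tm n → Tm n → Tm n

ren : ∀ {n m} → Ren n m → Tm n → Tm m
ren ρ (var i)   = var (ρ i)
ren ρ (lam t)   = lam (ren (liftR ρ) t)
ren ρ (app t u) = app (ren ρ t) (ren ρ u)

exts : ∀ {n m} → (Fin n → Tm m) → Fin (suc n) → Tm (suc m)
exts σ zero    = var zero
exts σ (suc i) = ren suc (σ i)

sub : ∀ {n m} → (Fin n → Tm m) → Tm n → Tm m
sub σ (var i)   = σ i
sub σ (lam t)   = lam (sub (exts σ) t)
sub σ (app t u) = app (sub σ t) (sub σ u)

sub0 : ∀ {n} → Tm n → Fin (suc n) → Tm n
sub0 u zero    = u
sub0 u (suc i) = var i

_[0:=_] : ∀ {n} → Tm (suc n) → Tm n → Tm n
t [0:= u ] = sub (sub0 u) t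

mutual
  data Fireball {n : ℕ} : Tm n → Set where
    fb-lam   : (t : Tm (suc n)) → Fireball (lam t)
    fb-inert : {i : Tm n} → Inert i → Fireball i

  data Inert {n : ℕ} : Tm n → Set where
    in-var : (x : Fin n) → Inert (var x)
    in-app : {i f : Tm n} → Inert i → Fireball f → Inert (app i f)

data _→βλ_ {n : ℕ} : Tm n → Tm n → Set where
  βλ-root : (t : Tm (suc n)) (u : Tm (suc n)) →
            app (lam t) (lam u) →βλ (t [0:= lam u ])
  βλ-appL : {t t' : Tm n} (u : Tm n) → t →βλ t' → app t u →βλ app t' u
  βλ-appR : (t : Tm n) {u u' : Tm n} → u →βλ u' → app t u →βλ app t u'

data _→βi_ {n : ℕ} : Tm n → Tm n → Set where
  βi-root : (t : Tm (suc n)) {i : Tm n} → Inert i →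
            app (lam t) i →βi (t [0:= i ])
  βi-appL : {t t' : Tm n} (u : Tm n) → t →βi t' → app t u →βi app t' u
  βi-appR : (t : Tm n) {u u' : Tm n} → u →βi u' → app t u →βi app t u'

-- vsub-terms  t ::= x | λx.t | t u | t[x←u]   (es t u = t[x←u], binds 0 in t)

data VT (n : ℕ) : Set where
  vvar : Fin n → VT n
  vlam : VT (suc n) → VT n
  vapp : VT n → VT n → VT n
  es   : VT (suc n) → VT n → VT n

vren : ∀ {n m} → Ren n m → VT n → VT m
vren ρ (vvar i)   = vvar (ρ i)
vren ρ (vlam t)   = vlam (vren (liftR ρ) t)
vren ρ (vapp t u) = vapp (vren ρ t) (vren ρ u)
vren ρ (es t u)   = es (vren (liftR ρ) t) (vren ρ u)

vexts : ∀ {n m} → (Fin n → VT m) → Fin (suc n) → VT (suc m)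
vexts σ zero    = vvar zero
vexts σ (suc i) = vren suc (σ i)

vsub : ∀ {n m} → (Fin n → VT m) → VT n → VT m
vsub σ (vvar i)   = σ i
vsub σ (vlam t)   = vlam (vsub (vexts σ) t)
vsub σ (vapp t u) = vapp (vsub σ t) (vsub σ u)
vsub σ (es t u)   = es (vsub (vexts σ) t) (vsub σ u)

vsub0 : ∀ {n} → VT n → Fin (suc n) → VT n
vsub0 u zero    = u
vsub0 u (suc i) = vvar i

-- meta-level capture-avoiding substitution t{x←u} on vsub-terms
_[0:=v_] : ∀ {n} → VT (suc n) → VT n → VT n
t [0:=v u ] = vsub (vsub0 u) t

emb : ∀ {n} → Tm n → VT n
emb (var i)   = vvar i
emb (lam t)   = vlam (emb t)
emb (app t u) = vapp (emb t) (emb u)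

-- Substitution contexts  L ::= ⟨·⟩ | L[x←u]
-- `SCtx n m`: plugging a term of scope m yields a term of scope n.

data SCtx : ℕ → ℕ → Set where
  hole : ∀ {n} → SCtx n n
  ext  : ∀ {n m} → SCtx (suc n) m → VT n → SCtx n m

plug : ∀ {n m} → SCtx n m → VT m → VT n
plug hole      t = t
plug (ext L u) t = es (plug L t) u

-- weakening past the variables bound by L (encodes "bound variables of L
-- are not free in ...")
wkL : ∀ {n m} → SCtx n m → Ren n m
wkL hole      i = i
wkL (ext L u) i = wkL L (suc i)

data _→m_ {n : ℕ} : VT n → VT n → Set where
  m-root : ∀ {k} (L : SCtx n k) (t : VT (suc k)) (u : VT n) →
           vapp (plug L (vlam t)) u →m plug L (es t (vren (wkL L) u))
  m-appL : {t t' : VT n} (u : VT n) → t →m t' → vapp t u →m vapp t' u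
  m-appR : (t : VT n) {u u' : VT n} → u →m u' → vapp t u →m vapp t u'
  m-esL  : {t t' : VT (suc n)} (u : VT n) → t →m t' → es t u →m es t' u
  m-esR  : (t : VT (suc n)) {u u' : VT n} → u →m u' → es t u →m es t u'

data _→eλ_ {n : ℕ} : VT n → VT n → Set where
  e-root : ∀ {k} (t : VT (suc n)) (L : SCtx n k) (u : VT (suc k)) →
           es t (plug L (vlam u)) →eλ plug L ((vren (liftR (wkL L)) t) [0:=v vlam u ])
  e-appL : {t t' : VT n} (u : VT n) → t →eλ t' → vapp t u →eλ vapp t' u
  e-appR : (t : VT n) {u u' : VT n} → u →eλ u' → vapp t u →eλ vapp t u'
  e-esL  : {t t' : VT (suc n)} (u : VT n) → t →eλ t' → es t u →eλ es t' u
  e-esR  : (t : VT (suc n)) {u u' : VT n} → u →eλ u' → es t u →eλ es t u'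

-- Structural equivalence: least equivalence closed under evaluation
-- contexts containing the four axioms (side conditions x ∉ fv(·) are
-- expressed by the term being a weakening).

data _≡vs_ : ∀ {n} → VT n → VT n → Set where
  -- t[y←s][x←u] ≡ t[x←u][y←s]   (y ∉ fv u, x ∉ fv s)
  ax-com  : ∀ {n} (t : VT (suc (suc n))) (s u : VT n) →
            es (es t (vren suc s)) u ≡vs es (es (vren swapR t) (vren suc u)) s
  -- t (s[x←u]) ≡ (t s)[x←u]   (x ∉ fv t)
  ax-appR : ∀ {n} (t : VT n) (s : VT (suc n)) (u : VT n) →
            vapp t (es s u) ≡vs es (vapp (vren suc t) s) u
  -- t[x←u] s ≡ (t s)[x←u]   (x ∉ fv s)
  ax-appL : ∀ {n} (t : VT (suc n)) (u : VT n) (s : VT n) →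
            vapp (es t u) s ≡vs es (vapp t (vren suc s)) u
  -- t[x←u[y←s]] ≡ t[x←u][y←s]   (y ∉ fv t)
  ax-es   : ∀ {n} (t : VT (suc n)) (u : VT (suc n)) (s : VT n) →
            es t (es u s) ≡vs es (es (vren (liftR suc) t) u) s
  ≡-refl  : ∀ {n} (t : VT n) → t ≡vs t
  ≡-sym   : ∀ {n} {t u : VT n} → t ≡vs u → u ≡vs t
  ≡-trans : ∀ {n} {t u s : VT n} → t ≡vs u → u ≡vs s → t ≡vs s
  ≡-appL  : ∀ {n} {t t' : VT n} (u : VT n) → t ≡vs t' → vapp t u ≡vs vapp t' u
  ≡-appR  : ∀ {n} (t : VT n) {u u' : VT n} → u ≡vs u' → vapp t u ≡vs vapp t u'
  ≡-esL   : ∀ {n} {t t' : VT (suc n)} (u : VT n) → t ≡vs t' → es t u ≡vs es t' u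
  ≡-esR   : ∀ {n} (t : VT (suc n)) {u u' : VT n} → u ≡vs u' → es t u ≡vs es t u'

unfold : ∀ {n} → VT n → Tm n
unfold (vvar i)   = var i
unfold (vlam t)   = lam (unfold t)
unfold (vapp t u) = app (unfold t) (unfold u)
unfold (es t u)   = unfold t [0:= unfold u ]

data Clean : ∀ {n} → VT n → Set where
  clean-base : ∀ {n} (u : Tm n) → Clean (emb u)
  clean-es   : ∀ {n} {t : VT (suc n)} {i : Tm n} →
               Clean t → Inert i → Clean (es t (emb i))

module Submission where

-- A clean term t = u[x₁←i₁]…[xₖ←iₖ] unfolds to u{x₁←i₁}…{xₖ←iₖ}
-- (innermost first).  Since the iⱼ are inert, hence normal and never
-- abstractions, substituting them creates no redex: every βλ/βi step of
-- u{x←i} is the image of a step of u (the step is REFLECTED by u).  So by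
-- induction on cleanliness it suffices to simulate a step of a plain
-- λ-term u, lifting the simulation under the explicit substitutions:
--   * a βλ step (λx.a)(λy.b) ↦ a{x←λy.b} becomes the m step to a[x←λy.b]
--     followed by the e_λ step firing it, ending in a λ-term (clean);
--   * a βi step (λx.a) i ↦ a{x←i} becomes the m step to a[x←i], which stays
--     as an inert explicit substitution; structural equivalence floats it out
--     of the surrounding applications, ending in the clean term c[x←i].

open import Defs
open import Data.Product using (Σ; _×_; _,_)
open import Relation.Binary.PropositionalEquality
  using (_≡_; refl; sym; trans; cong; cong₂; subst; module ≡-Reasoning)
open import Data.Nat using (ℕ; suc)
open import Data.Fin using (Fin; zero; suc)
open import Data.Empty using (⊥; ⊥-elim)

liftR-cong : ∀ {n m} {ρ ρ' : Ren n m} → (∀ x → ρ x ≡ ρ' x) → ∀ x → liftR ρ x ≡ liftR ρ' x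
liftR-cong h zero    = refl
liftR-cong h (suc x) = cong suc (h x)

ren-cong : ∀ {n m} {ρ ρ' : Ren n m} → (∀ x → ρ x ≡ ρ' x) → ∀ t → ren ρ t ≡ ren ρ' t
ren-cong h (var x)   = cong var (h x)
ren-cong h (lam t)   = cong lam (ren-cong (liftR-cong h) t)
ren-cong h (app t u) = cong₂ app (ren-cong h t) (ren-cong h u)

exts-cong : ∀ {n m} {σ τ : Fin n → Tm m} → (∀ x → σ x ≡ τ x) → ∀ x → exts σ x ≡ exts τ x
exts-cong h zero    = refl
exts-cong h (suc x) = cong (ren suc) (h x)

sub-cong : ∀ {n m} {σ τ : Fin n → Tm m} → (∀ x → σ x ≡ τ x) → ∀ t → sub σ t ≡ sub τ t
sub-cong h (var x)   = h x
sub-cong h (lam t)   = cong lam (sub-cong (exts-cong h) t)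
sub-cong h (app t u) = cong₂ app (sub-cong h t) (sub-cong h u)

liftR-comp : ∀ {n m k} (ρ : Ren m k) (ρ' : Ren n m) →
             ∀ x → liftR ρ (liftR ρ' x) ≡ liftR (λ y → ρ (ρ' y)) x
liftR-comp ρ ρ' zero    = refl
liftR-comp ρ ρ' (suc x) = refl

ren-ren : ∀ {n m k} (ρ : Ren m k) (ρ' : Ren n m) t →
          ren ρ (ren ρ' t) ≡ ren (λ x → ρ (ρ' x)) t
ren-ren ρ ρ' (var x)   = refl
ren-ren ρ ρ' (lam t)   =
  cong lam (trans (ren-ren (liftR ρ) (liftR ρ') t) (ren-cong (liftR-comp ρ ρ') t))
ren-ren ρ ρ' (app t u) = cong₂ app (ren-ren ρ ρ' t) (ren-ren ρ ρ' u)

ren-sub : ∀ {n m k} (ρ : Ren m k) (σ : Fin n → Tm m) t →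
          ren ρ (sub σ t) ≡ sub (λ x → ren ρ (σ x)) t
ren-sub ρ σ (var x)   = refl
ren-sub ρ σ (lam t)   = cong lam (trans (ren-sub (liftR ρ) (exts σ) t) (sub-cong lift-exts t))
  where
  lift-exts : ∀ x → ren (liftR ρ) (exts σ x) ≡ exts (λ y → ren ρ (σ y)) x
  lift-exts zero    = refl
  lift-exts (suc x) = trans (ren-ren (liftR ρ) suc (σ x)) (sym (ren-ren suc ρ (σ x)))
ren-sub ρ σ (app t u) = cong₂ app (ren-sub ρ σ t) (ren-sub ρ σ u)

sub-ren : ∀ {n m k} (σ : Fin m → Tm k) (ρ : Ren n m) t →
          sub σ (ren ρ t) ≡ sub (λ x → σ (ρ x)) t
sub-ren σ ρ (var x)   = refl
sub-ren σ ρ (lam t)   = cong lam (trans (sub-ren (exts σ) (liftR ρ) t) (sub-cong exts-lift t))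
  where
  exts-lift : ∀ x → exts σ (liftR ρ x) ≡ exts (λ y → σ (ρ y)) x
  exts-lift zero    = refl
  exts-lift (suc x) = refl
sub-ren σ ρ (app t u) = cong₂ app (sub-ren σ ρ t) (sub-ren σ ρ u)

sub-sub : ∀ {n m k} (σ : Fin m → Tm k) (τ : Fin n → Tm m) t →
          sub σ (sub τ t) ≡ sub (λ x → sub σ (τ x)) t
sub-sub σ τ (var x)   = refl
sub-sub σ τ (lam t)   = cong lam (trans (sub-sub (exts σ) (exts τ) t) (sub-cong exts-exts t))
  where
  exts-exts : ∀ x → sub (exts σ) (exts τ x) ≡ exts (λ y → sub σ (τ y)) x
  exts-exts zero    = refl
  exts-exts (suc x) = trans (sub-ren (exts σ) suc (τ x)) (sym (ren-sub suc σ (τ x)))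
sub-sub σ τ (app t u) = cong₂ app (sub-sub σ τ t) (sub-sub σ τ u)

sub-id : ∀ {n} (σ : Fin n → Tm n) → (∀ x → σ x ≡ var x) → ∀ t → sub σ t ≡ t
sub-id σ h (var x)   = h x
sub-id σ h (lam t)   = cong lam (sub-id (exts σ) exts-id t)
  where
  exts-id : ∀ x → exts σ x ≡ var x
  exts-id zero    = refl
  exts-id (suc x) = cong (ren suc) (h x)
sub-id σ h (app t u) = cong₂ app (sub-id σ h t) (sub-id σ h u)

weaken-[0:=] : ∀ {n} (b d : Tm n) → (ren suc d) [0:= b ] ≡ d
weaken-[0:=] b d = trans (sub-ren (sub0 b) suc d) (sub-id _ (λ _ → refl) d)

sub-[0:=] : ∀ {n m} (σ : Fin n → Tm m) (a : Tm (suc n)) (u : Tm n) →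
            sub σ (a [0:= u ]) ≡ (sub (exts σ) a) [0:= sub σ u ]
sub-[0:=] σ a u = begin
  sub σ (sub (sub0 u) a)                         ≡⟨ sub-sub σ (sub0 u) a ⟩
  sub (λ x → sub σ (sub0 u x)) a                 ≡⟨ sub-cong agree a ⟩
  sub (λ x → sub (sub0 (sub σ u)) (exts σ x)) a  ≡⟨ sym (sub-sub (sub0 (sub σ u)) (exts σ) a) ⟩
  sub (sub0 (sub σ u)) (sub (exts σ) a)          ∎
  where
  open ≡-Reasoning
  agree : ∀ x → sub σ (sub0 u x) ≡ sub (sub0 (sub σ u)) (exts σ x)
  agree zero    = refl
  agree (suc x) = sym (weaken-[0:=] (sub σ u) (σ x))

unfold-emb : ∀ {n} (u : Tm n) → unfold (emb u) ≡ u
unfold-emb (var x)   = refl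
unfold-emb (lam u)   = cong lam (unfold-emb u)
unfold-emb (app t u) = cong₂ app (unfold-emb t) (unfold-emb u)

emb-ren : ∀ {n m} (ρ : Ren n m) t → emb (ren ρ t) ≡ vren ρ (emb t)
emb-ren ρ (var x)   = refl
emb-ren ρ (lam t)   = cong vlam (emb-ren (liftR ρ) t)
emb-ren ρ (app t u) = cong₂ vapp (emb-ren ρ t) (emb-ren ρ u)

emb-sub : ∀ {n m} (σ : Fin n → Tm m) (τ : Fin n → VT m) → (∀ x → emb (σ x) ≡ τ x) →
          ∀ t → emb (sub σ t) ≡ vsub τ (emb t)
emb-sub σ τ h (var x)   = h x
emb-sub σ τ h (lam t)   = cong vlam (emb-sub (exts σ) (vexts τ) h' t)
  where
  h' : ∀ x → emb (exts σ x) ≡ vexts τ x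
  h' zero    = refl
  h' (suc x) = trans (emb-ren suc (σ x)) (cong (vren suc) (h x))
emb-sub σ τ h (app t u) = cong₂ vapp (emb-sub σ τ h t) (emb-sub σ τ h u)

emb-[0:=] : ∀ {n} (a : Tm (suc n)) (b : Tm n) → emb (a [0:= b ]) ≡ (emb a [0:=v emb b ])
emb-[0:=] a b = emb-sub (sub0 b) (vsub0 (emb b)) agree a
  where
  agree : ∀ x → emb (sub0 b x) ≡ vsub0 (emb b) x
  agree zero    = refl
  agree (suc x) = refl

liftR-id : ∀ {n} {ρ : Ren n n} → (∀ x → ρ x ≡ x) → ∀ x → liftR ρ x ≡ x
liftR-id h zero    = refl
liftR-id h (suc x) = cong suc (h x)

vren-id : ∀ {n} (ρ : Ren n n) → (∀ x → ρ x ≡ x) → ∀ t → vren ρ t ≡ t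
vren-id ρ h (vvar x)   = cong vvar (h x)
vren-id ρ h (vlam t)   = cong vlam (vren-id (liftR ρ) (liftR-id h) t)
vren-id ρ h (vapp t u) = cong₂ vapp (vren-id ρ h t) (vren-id ρ h u)
vren-id ρ h (es t u)   = cong₂ es (vren-id (liftR ρ) (liftR-id h) t) (vren-id ρ h u)

m-root₀ : ∀ {n} (t : VT (suc n)) (u : VT n) → vapp (vlam t) u →m es t u
m-root₀ t u = subst (λ z → vapp (vlam t) u →m es t z)
                    (vren-id (λ x → x) (λ _ → refl) u) (m-root hole t u)

e-root₀ : ∀ {n} (t : VT (suc n)) (u : VT (suc n)) → es t (vlam u) →eλ (t [0:=v vlam u ])
e-root₀ t u = subst (λ z → es t (vlam u) →eλ (z [0:=v vlam u ]))
                    (vren-id (liftR (λ x → x)) (liftR-id (λ _ → refl)) t) (e-root t hole u)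

mutual
  inert-nfλ : ∀ {n} {i w : Tm n} → Inert i → i →βλ w → ⊥
  inert-nfλ (in-var x)    ()
  inert-nfλ (in-app () _) (βλ-root _ _)
  inert-nfλ (in-app i f)  (βλ-appL _ s) = inert-nfλ i s
  inert-nfλ (in-app i f)  (βλ-appR _ s) = fireball-nfλ f s

  fireball-nfλ : ∀ {n} {f w : Tm n} → Fireball f → f →βλ w → ⊥
  fireball-nfλ (fb-lam t)   ()
  fireball-nfλ (fb-inert i) s = inert-nfλ i s

mutual
  inert-nfi : ∀ {n} {i w : Tm n} → Inert i → i →βi w → ⊥
  inert-nfi (in-var x)    ()
  inert-nfi (in-app () _) (βi-root _ _)
  inert-nfi (in-app i f)  (βi-appL _ s) = inert-nfi i s
  inert-nfi (in-app i f)  (βi-appR _ s) = fireball-nfi f s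

  fireball-nfi : ∀ {n} {f w : Tm n} → Fireball f → f →βi w → ⊥
  fireball-nfi (fb-lam t)   ()
  fireball-nfi (fb-inert i) s = inert-nfi i s

lam-inert-nfλ : ∀ {n} {c : Tm (suc n)} {i w : Tm n} → Inert i → app (lam c) i →βλ w → ⊥
lam-inert-nfλ ()  (βλ-root _ _)
lam-inert-nfλ ii  (βλ-appR _ s) = inert-nfλ ii s

inert-head-stepλ : ∀ {n} {i d w : Tm n} → Inert i → app i d →βλ w →
                   Σ (Tm n) (λ d' → (d →βλ d') × (w ≡ app i d'))
inert-head-stepλ ()  (βλ-root _ _)
inert-head-stepλ ii  (βλ-appL _ s) = ⊥-elim (inert-nfλ ii s)
inert-head-stepλ ii  (βλ-appR _ s) = _ , s , refl

inert-head-stepi : ∀ {n} {i d w : Tm n} → Inert i → app i d →βi w →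
                   Σ (Tm n) (λ d' → (d →βi d') × (w ≡ app i d'))
inert-head-stepi ()  (βi-root _ _)
inert-head-stepi ii  (βi-appL _ s) = ⊥-elim (inert-nfi ii s)
inert-head-stepi ii  (βi-appR _ s) = _ , s , refl

-- Inertness is reflected by any substitution: if dσ is inert, so is d
-- (an inert image cannot come from an abstraction).
mutual
  inert-unsub : ∀ {n m} (σ : Fin n → Tm m) (d : Tm n) → Inert (sub σ d) → Inert d
  inert-unsub σ (var x)   _            = in-var x
  inert-unsub σ (lam d)   ()
  inert-unsub σ (app c e) (in-app i f) = in-app (inert-unsub σ c i) (fireball-unsub σ e f)

  fireball-unsub : ∀ {n m} (σ : Fin n → Tm m) (d : Tm n) → Fireball (sub σ d) → Fireball d
  fireball-unsub σ (var x)   _            = fb-inert (in-var x)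
  fireball-unsub σ (lam d)   _            = fb-lam d
  fireball-unsub σ (app c e) (fb-inert i) = fb-inert (inert-unsub σ (app c e) i)

InertSubst : ∀ {n m} → (Fin n → Tm m) → Set
InertSubst σ = ∀ x → Inert (σ x)

sub0-inert : ∀ {n} {i : Tm n} → Inert i → InertSubst (sub0 i)
sub0-inert ii zero    = ii
sub0-inert ii (suc x) = in-var x

Reflected : ∀ {n m} → (Tm n → Tm n → Set) → (Fin n → Tm m) → Tm n → Tm m → Set
Reflected {n} _⟶_ σ v w = Σ (Tm n) (λ v' → (v ⟶ v') × (sub σ v' ≡ w))

-- every βλ step of vσ, σ inert, is reflected by v: redexes of vσ are images
-- of redexes of v, because σ introduces neither abstractions nor redexes
reflect-βλ : ∀ {n m} (σ : Fin n → Tm m) → InertSubst σ → (v : Tm n) {w : Tm m} →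
             sub σ v →βλ w → Reflected _→βλ_ σ v w
reflect-βλ σ inert (var x) s = ⊥-elim (inert-nfλ (inert x) s)
reflect-βλ σ inert (lam v) ()
reflect-βλ σ inert (app (var x) d) s with inert-head-stepλ (inert x) s
... | d' , s' , refl with reflect-βλ σ inert d s'
...   | d'' , s'' , refl = app (var x) d'' , βλ-appR _ s'' , refl
reflect-βλ σ inert (app (lam c) (var x)) s = ⊥-elim (lam-inert-nfλ (inert x) s)
reflect-βλ σ inert (app (lam c) (lam d)) (βλ-root _ _) =
  c [0:= lam d ] , βλ-root c d , sub-[0:=] σ c (lam d)
reflect-βλ σ inert (app (lam c) (app d e)) (βλ-appR _ s) with reflect-βλ σ inert (app d e) s
... | d' , s' , refl = app (lam c) d' , βλ-appR _ s' , refl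
reflect-βλ σ inert (app (app c e) d) (βλ-appL _ s) with reflect-βλ σ inert (app c e) s
... | c' , s' , refl = app c' d , βλ-appL _ s' , refl
reflect-βλ σ inert (app (app c e) d) (βλ-appR _ s) with reflect-βλ σ inert d s
... | d' , s' , refl = app (app c e) d' , βλ-appR _ s' , refl

-- the same for βi; at the root the argument is inert after σ, hence before
reflect-βi : ∀ {n m} (σ : Fin n → Tm m) → InertSubst σ → (v : Tm n) {w : Tm m} →
             sub σ v →βi w → Reflected _→βi_ σ v w
reflect-βi σ inert (var x) s = ⊥-elim (inert-nfi (inert x) s)
reflect-βi σ inert (lam v) ()
reflect-βi σ inert (app (var x) d) s with inert-head-stepi (inert x) s
... | d' , s' , refl with reflect-βi σ inert d s'
...   | d'' , s'' , refl = app (var x) d'' , βi-appR _ s'' , refl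
reflect-βi σ inert (app (lam c) d) (βi-root _ i) =
  c [0:= d ] , βi-root c (inert-unsub σ d i) , sub-[0:=] σ c d
reflect-βi σ inert (app (lam c) d) (βi-appR _ s) with reflect-βi σ inert d s
... | d' , s' , refl = app (lam c) d' , βi-appR _ s' , refl
reflect-βi σ inert (app (app c e) d) (βi-appL _ s) with reflect-βi σ inert (app c e) s
... | c' , s' , refl = app c' d , βi-appL _ s' , refl
reflect-βi σ inert (app (app c e) d) (βi-appR _ s) with reflect-βi σ inert d s
... | d' , s' , refl = app (app c e) d' , βi-appR _ s' , refl

simulate-βλ : ∀ {n} {u w : Tm n} → u →βλ w → Σ (VT n) (λ r → (emb u →m r) × (r →eλ emb w))
simulate-βλ (βλ-root a b) =
  es (emb a) (vlam (emb b)) ,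
  m-root₀ (emb a) (vlam (emb b)) ,
  subst (λ z → es (emb a) (vlam (emb b)) →eλ z) (sym (emb-[0:=] a (lam b))) (e-root₀ (emb a) (emb b))
simulate-βλ (βλ-appL d s) with simulate-βλ s
... | r , m , e = vapp r (emb d) , m-appL _ m , e-appL _ e
simulate-βλ (βλ-appR d s) with simulate-βλ s
... | r , m , e = vapp (emb d) r , m-appR _ m , e-appR _ e

record InertSimulation {n : ℕ} (u w : Tm n) : Set where
  constructor inert-sim
  field
    reduct    : VT n
    body      : Tm (suc n)
    argument  : Tm n
    inert     : Inert argument
    m-step    : emb u →m reduct
    floated   : reduct ≡vs es (emb body) (emb argument)
    unfolds   : body [0:= argument ] ≡ w

-- the explicit substitution created at the root is floated out of the
-- enclosing applications by the axioms t[x←i] s ≡ (t s)[x←i] and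
-- s (t[x←i]) ≡ (s t)[x←i]
simulate-βi : ∀ {n} {u w : Tm n} → u →βi w → InertSimulation u w
simulate-βi (βi-root a {i} ii) =
  inert-sim _ a i ii (m-root₀ (emb a) (emb i)) (≡-refl _) refl
simulate-βi (βi-appL d s) with simulate-βi s
... | inert-sim r c b ib m q e =
  inert-sim (vapp r (emb d)) (app c (ren suc d)) b ib (m-appL _ m)
    (subst (λ z → vapp r (emb d) ≡vs es (vapp (emb c) z) (emb b)) (sym (emb-ren suc d))
      (≡-trans (≡-appL (emb d) q) (ax-appL (emb c) (emb b) (emb d))))
    (cong₂ app e (weaken-[0:=] b d))
simulate-βi (βi-appR d s) with simulate-βi s
... | inert-sim r c b ib m q e =
  inert-sim (vapp (emb d) r) (app (ren suc d) c) b ib (m-appR _ m)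
    (subst (λ z → vapp (emb d) r ≡vs es (vapp z (emb c)) (emb b)) (sym (emb-ren suc d))
      (≡-trans (≡-appR (emb d) q) (ax-appR (emb d) (emb c) (emb b))))
    (cong₂ app (weaken-[0:=] b d) e)

unfold-es-emb : ∀ {n} (t : VT (suc n)) (i : Tm n) → unfold (es t (emb i)) ≡ unfold t [0:= i ]
unfold-es-emb t i = cong (unfold t [0:=_]) (unfold-emb i)

clean-βλ : ∀ {n} (t : VT n) (u : Tm n) → Clean t → (unfold t →βλ u) →
           Σ (VT n) (λ r → Σ (VT n) (λ s → (t →m r) × (r →eλ s) × Clean s × (unfold s ≡ u)))
clean-βλ .(emb v) w (clean-base v) st
  with simulate-βλ (subst (_→βλ w) (unfold-emb v) st)
... | r , m , e = r , emb w , m , e , clean-base w , unfold-emb w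
clean-βλ .(es t (emb i)) w (clean-es {t = t} {i = i} ct ii) st
  with reflect-βλ (sub0 i) (sub0-inert ii) (unfold t) (subst (_→βλ w) (unfold-es-emb t i) st)
... | v , sv , eq with clean-βλ t v ct sv
...   | r , s , m , e , cs , us =
  es r (emb i) , es s (emb i) , m-esL _ m , e-esL _ e , clean-es cs ii ,
  trans (unfold-es-emb s i) (trans (cong (_[0:= i ]) us) eq)

clean-βi : ∀ {n} (t : VT n) (u : Tm n) → Clean t → (unfold t →βi u) →
           Σ (VT n) (λ r → Σ (VT n) (λ s → (t →m r) × (r ≡vs s) × Clean s × (unfold s ≡ u)))
clean-βi .(emb v) w (clean-base v) st
  with simulate-βi (subst (_→βi w) (unfold-emb v) st)
... | inert-sim r c b ib m q e =
  r , es (emb c) (emb b) , m , q , clean-es (clean-base c) ib ,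
  trans (unfold-es-emb (emb c) b) (trans (cong (_[0:= b ]) (unfold-emb c)) e)
clean-βi .(es t (emb i)) w (clean-es {t = t} {i = i} ct ii) st
  with reflect-βi (sub0 i) (sub0-inert ii) (unfold t) (subst (_→βi w) (unfold-es-emb t i) st)
... | v , sv , eq with clean-βi t v ct sv
...   | r , s , m , q , cs , us =
  es r (emb i) , es s (emb i) , m-esL _ m , ≡-esL _ q , clean-es cs ii ,
  trans (unfold-es-emb s i) (trans (cong (_[0:= i ]) us) eq)

lemma3 : ∀ {n} (t : VT n) (u : Tm n) → Clean t →
             ((unfold t →βλ u) →
                Σ (VT n) (λ r → Σ (VT n) (λ s →
                  (t →m r) × (r →eλ s) × Clean s × (unfold s ≡ u))))
             ×
             ((unfold t →βi u) →
                Σ (VT n) (λ r → Σ (VT n) (λ s →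
                  (t →m r) × (r ≡vs s) × Clean s × (unfold s ≡ u))))
lemma3 t u c = clean-βλ t u c , clean-βi t u c
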